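{- For a finite graph $G$ and integer $k$, let $h_k(G)$ be the number of $k$-components Hamiltonian cycles of $G$ (with $h_k=0$ for $k<0$). Then: (1) if $e$ is an edge of $G$ with two distinct endpoints $u\neq v$, then $h_k(G)=h_k(G-e)+h_k(G/e)-h_k(G-u)-h_k(G-v)$; (2) if $G=G_1+G_2$ is the disjoint union of nonempty graphs $G_1,G_2$, then $h_k(G_1+G_2)=\sum_i h_i(G_1)h_{k-i}(G_2)$; (3) $h_1(K_1^n)=n$ and $h_k(K_1^n)=0$ for $k\neq 1$.
   Context: Graphs are finite triples $G=(V,E,\varphi)$ with loops and multiple edges allowed, $\varphi$ mapping each edge to an unordered pair of (possibly equal) vertices; graphs are nonempty unless stated otherwise. Degrees count loops twice. A $k$-components Hamiltonian cycle of $G$ is a spanning subgraph $H$ of $G$ (same vertex set, subset of edges) with exactly $k$ connected components in which every vertex has degree $2$; such subgraphs are counted as subgraphs. $K_1^n$ is the graph with one vertex and $n$ loops. For an edge $e$ with endpoints $u\neq v$: $G-e$ deletes $e$; $G/e$ deletes $e$ and identifies $u$ and $v$ (other edges between $u$ and $v$ become loops); $G-u$ deletes $u$ and all edges incident with it. -}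

module Defs where

open import Data.Nat using (ℕ; zero; suc; _+_; _*_; _∸_; _<ᵇ_; _≡ᵇ_)
open import Data.Bool using (Bool; true; false; _∧_; _∨_; not)
open import Data.Fin using (Fin; punchOut; _↑ˡ_; _↑ʳ_; toℕ) renaming (zero to fzero)
open import Data.Fin.Properties using (_≟_)
open import Data.Product using (_×_; _,_; proj₁; proj₂)
open import Data.List using (List; []; _∷_; _++_; map; length; lookup; removeAt; filterᵇ; allFin; replicate; upTo)
open import Data.Bool.ListAction using (all; any)
open import Data.Nat.ListAction using (sum)
open import Relation.Nullary using (yes; no; ¬_)
open import Relation.Nullary.Decidable using (⌊_⌋)
open import Relation.Binary.PropositionalEquality using (_≡_; _≢_; refl; sym)

-- The edge set is the set of positions in
-- the list, so parallel edges are distinct edges; a pair (a , b) stands for the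
-- unordered pair {a , b} (all notions below are symmetric in a and b).
Graph : ℕ → Set
Graph n = List (Fin n × Fin n)

-- all spanning subgraphs: every choice of a subset of edge positions
subgraphs : ∀ {A : Set} → List A → List (List A)
subgraphs []       = [] ∷ []
subgraphs (x ∷ xs) = map (x ∷_) (subgraphs xs) ++ subgraphs xs

_==_ : ∀ {n} → Fin n → Fin n → Bool
a == b = ⌊ a ≟ b ⌋

b2n : Bool → ℕ
b2n true  = 1
b2n false = 0

-- degree of v in the graph (loops count twice)
deg : ∀ {n} → Graph n → Fin n → ℕ
deg H v = sum (map (λ ab → b2n (proj₁ ab == v) + b2n (proj₂ ab == v)) H)

reach : ∀ {n} → Graph n → ℕ → Fin n → Fin n → Bool
reach H zero    x y = x == y
reach H (suc s) x y =
  reach H s x y ∨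
  any (λ ab → (reach H s x (proj₁ ab) ∧ (proj₂ ab == y)) ∨
              (reach H s x (proj₂ ab) ∧ (proj₁ ab == y))) H

-- connected in H (walks of length ≤ n suffice)
connected : ∀ {n} → Graph n → Fin n → Fin n → Bool
connected {n} H x y = reach H n x y

-- number of connected components = number of vertices that are the least
-- vertex of their component
components : ∀ {n} → Graph n → ℕ
components {n} H =
  length (filterᵇ (λ v → not (any (λ u → (toℕ u <ᵇ toℕ v) ∧ connected H u v) (allFin n)))
                  (allFin n))

isHam : ∀ {n} → ℕ → Graph n → Bool
isHam {n} k H = all (λ v → deg H v ≡ᵇ 2) (allFin n) ∧ (components H ≡ᵇ k)

h : ∀ {n} → ℕ → Graph n → ℕ
h k G = length (filterᵇ (isHam k) (subgraphs G))

deleteEdge : ∀ {n} (G : Graph n) → Fin (length G) → Graph n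
deleteEdge G e = removeAt G e

src tgt : ∀ {n} (G : Graph n) → Fin (length G) → Fin n
src G e = proj₁ (lookup G e)
tgt G e = proj₂ (lookup G e)

-- identify u with v (v is removed, u survives under the new numbering)
merge : ∀ {n} {u v : Fin (suc n)} → u ≢ v → Fin (suc n) → Fin n
merge {u = u} {v} u≢v w with v ≟ w
... | yes _   = punchOut {i = v} {j = u} (λ eq → u≢v (sym eq))
... | no v≢w  = punchOut v≢w

contract : ∀ {n} (G : Graph (suc n)) (e : Fin (length G)) → src G e ≢ tgt G e → Graph n
contract G e u≢v = map (λ ab → merge u≢v (proj₁ ab) , merge u≢v (proj₂ ab)) (removeAt G e)

deleteVertex : ∀ {n} → Graph (suc n) → Fin (suc n) → Graph n
deleteVertex []             u = []
deleteVertex ((a , b) ∷ es) u with u ≟ a | u ≟ b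
... | no u≢a | no u≢b = (punchOut u≢a , punchOut u≢b) ∷ deleteVertex es u
... | _      | _      = deleteVertex es u

_⊕_ : ∀ {n₁ n₂} → Graph n₁ → Graph n₂ → Graph (n₁ + n₂)
_⊕_ {n₁} {n₂} G₁ G₂ =
  map (λ ab → (proj₁ ab ↑ˡ n₂) , (proj₂ ab ↑ˡ n₂)) G₁ ++
  map (λ ab → (n₁ ↑ʳ proj₁ ab) , (n₁ ↑ʳ proj₂ ab)) G₂

K1 : ℕ → Graph 1
K1 n = replicate n (fzero , fzero)

-- Σ_{i=0}^{k} h_i(G₁) h_{k-i}(G₂)  (terms with i<0 or k-i<0 vanish)
convolution : ∀ {n₁ n₂} → ℕ → Graph n₁ → Graph n₂ → ℕ
convolution k G₁ G₂ = sum (map (λ i → h i G₁ * h (k ∸ i) G₂) (upTo (suc k)))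

-- (1) Split the spanning subgraphs of G by whether they contain e = uv and compare, for every spanning
-- subgraph H of G − e, four indicators: H + e in G, H in G − u, H in G − v and H in G / e.  All vertices
-- other than u, v must have degree 2; then H is 2-regular in G / e iff deg u + deg v = 2 in H, i.e. iff
-- (deg u, deg v) is (1, 1), (0, 2) or (2, 0), and these are exactly the cases H + e, H in G − u and
-- H in G − v.  The component counts agree as well: H in G / e is (H + e) / e in the first case and H
-- with its isolated vertex u, resp. v, removed in the other two.  All component counts reduce to one
-- fact: adding an edge lowers the number of components by one if its endpoints were disconnected and
-- leaves it unchanged otherwise.
-- (2) A spanning subgraph of G₁ + G₂ is a pair of spanning subgraphs; degrees are computed separately
-- and component counts add up.  (3) The 2-regular spanning subgraphs of K₁ⁿ are its single loops.

module Submission where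

module HamiltonianCycleCounts where

  open import Defs
  open import Data.Bool using (Bool; true; false; _∧_; _∨_; not; T; T?)
  open import Data.Bool.ListAction using (all; any; or; and)
  open import Data.Bool.Properties using (T-∧; T-∨; ∧-identityʳ; ∧-zeroʳ)
  open import Data.Empty using (⊥-elim)
  open import Data.Fin using (Fin; toℕ; punchOut; punchIn; _↑ˡ_; _↑ʳ_; splitAt) renaming (zero to fzero; suc to fsuc)
  open import Data.Fin.Properties
    using (_≟_; any?; toℕ-injective; ↑ˡ-injective; ↑ʳ-injective;
           splitAt-↑ˡ; splitAt-↑ʳ; splitAt⁻¹-↑ˡ; splitAt⁻¹-↑ʳ; punchOut-cong; punchOut-injective; punchOut-punchIn; punchInᵢ≢i)
  import Data.Fin.Properties as Fin
  open import Data.List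
    using (List; []; _∷_; _++_; map; upTo; applyUpTo; lookup; removeAt; allFin; length; filterᵇ; tabulate)
  open import Data.List.Membership.Propositional using (_∈_; find; lose)
  open import Data.List.Membership.Propositional.Properties using (∈-allFin; ∈-map⁺; ∈-map⁻; ∈-++⁺ˡ; ∈-++⁻)
  open import Data.List.Properties
    using (length-replicate; map-applyUpTo; map-cong; map-∘; map-++; filter-++; length-++; filter-≐; filter-none)
  open import Data.List.Relation.Binary.Permutation.Propositional using (_↭_; ↭-refl; ↭-sym; prep; swap)
  import Data.List.Relation.Binary.Permutation.Propositional as ↭
  open import Data.List.Relation.Binary.Permutation.Propositional.Properties using (∈-resp-↭; ++⁺ˡ; map⁺; All-resp-↭)
  import Data.List.Relation.Unary.All as All
  open import Data.List.Relation.Unary.All.Properties using (all⁺; all⁻)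
  open import Data.List.Relation.Unary.Any using (here; there)
  open import Data.List.Relation.Unary.Any.Properties using (any⁺; any⁻)
  open import Data.Nat using (ℕ; zero; suc; _+_; _*_; _∸_; _≤_; _<_; _≤?_; _<?_; _≤ᵇ_; _<ᵇ_; _≡ᵇ_; z≤n; s≤s)
  open import Data.Nat.ListAction using (sum)
  open import Data.Nat.ListAction.Properties using (sum-↭; sum-++)
  open import Data.Nat.Properties
    using (≤-refl; ≤-trans; ≤-pred; <-irrefl; <-cmp; <-≤-trans; <⇒≤; ≰⇒>; m≤n⇒m≤1+n; n≤1+n; m≤n⇒∃[o]m+o≡n;
           +-comm; +-assoc; +-suc; +-identityʳ; +-cancelʳ-≡; *-distribʳ-+; suc-injective;
           <ᵇ⇒<; <⇒<ᵇ; ≡ᵇ⇒≡; ≡⇒≡ᵇ; +-commutativeSemigroup)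
  open import Algebra.Properties.CommutativeSemigroup +-commutativeSemigroup using (interchange; xy∙z≈zy∙x)
  import Data.Nat.Solver
  open import Data.Product using (_×_; _,_; proj₁; proj₂; ∃-syntax)
  open import Data.Sum using (_⊎_; inj₁; inj₂)
  import Data.Sum as Sum
  open import Data.Unit using (tt)
  open import Function using (_∘_; _⇔_; mk⇔; Equivalence)
  open import Relation.Binary using (tri<; tri≈; tri>)
  open import Relation.Binary.Construct.Closure.ReflexiveTransitive using (Star; ε; _◅_; _◅◅_; _⋆)
  import Relation.Binary.Construct.Closure.ReflexiveTransitive as Star
  open import Relation.Binary.PropositionalEquality
    using (_≡_; _≢_; refl; sym; trans; cong; cong₂; subst; module ≡-Reasoning)
  open import Relation.Nullary using (Dec; yes; no; ¬_; ¬?; _×-dec_)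
  open import Relation.Nullary.Decidable using (toWitness; fromWitness; decidable-stable)
  import Relation.Nullary.Decidable as Dec

  module ℕ-Solver = Data.Nat.Solver.+-*-Solver
  open Equivalence using (to; from)
  open ≡-Reasoning

  T-≡ext : ∀ {a b} → (T a → T b) → (T b → T a) → a ≡ b
  T-≡ext {true}  {true}  _ _ = refl
  T-≡ext {true}  {false} f _ = ⊥-elim (f tt)
  T-≡ext {false} {true}  _ g = ⊥-elim (g tt)
  T-≡ext {false} {false} _ _ = refl

  ==⇒≡ : ∀ {n} {a b : Fin n} → T (a == b) → a ≡ b
  ==⇒≡ = toWitness

  ≡⇒== : ∀ {n} {a b : Fin n} → a ≡ b → T (a == b)
  ≡⇒== = fromWitness

  ==-refl : ∀ {n} (a : Fin n) → (a == a) ≡ true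
  ==-refl a with a ≟ a
  ... | yes _  = refl
  ... | no a≢a = ⊥-elim (a≢a refl)

  ==-≢ : ∀ {n} {a b : Fin n} → a ≢ b → (a == b) ≡ false
  ==-≢ {a = a} {b} a≢b with a ≟ b
  ... | yes a≡b = ⊥-elim (a≢b a≡b)
  ... | no _    = refl

  ==-sym : ∀ {n} (a b : Fin n) → (a == b) ≡ (b == a)
  ==-sym a b = T-≡ext (≡⇒== ∘ sym ∘ ==⇒≡) (≡⇒== ∘ sym ∘ ==⇒≡)

  T-all-allFin : ∀ {n} (p : Fin n → Bool) → T (all p (allFin n)) ⇔ (∀ i → T (p i))
  T-all-allFin {n} p = mk⇔ (λ t i → All.lookup (all⁺ p (allFin n) t) (∈-allFin i))
                           (λ f → all⁻ p {allFin n} (All.tabulate (λ {i} _ → f i)))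

  T-any-allFin : ∀ {n} (p : Fin n → Bool) → T (any p (allFin n)) ⇔ (∃[ i ] T (p i))
  T-any-allFin {n} p = mk⇔ (λ t → let i , _ , pi = find (any⁻ p (allFin n) t) in i , pi)
                           (λ (i , pi) → any⁺ {xs = allFin n} p (lose (∈-allFin i) pi))

  <ᵇ-suc : ∀ c k → (c <ᵇ suc k) ≡ (c ≤ᵇ k)
  <ᵇ-suc zero    k = refl
  <ᵇ-suc (suc c) k = refl

  ≡ᵇ-+ : ∀ c t k → (c + t ≡ᵇ k) ≡ (c ≤ᵇ k) ∧ (t ≡ᵇ k ∸ c)
  ≡ᵇ-+ zero    t k       = refl
  ≡ᵇ-+ (suc c) t zero    = refl
  ≡ᵇ-+ (suc c) t (suc k) = trans (≡ᵇ-+ c t k) (cong (_∧ (t ≡ᵇ k ∸ c)) (sym (<ᵇ-suc c k)))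

  sum-map-+ : ∀ {A : Set} (f g : A → ℕ) xs → sum (map (λ x → f x + g x) xs) ≡ sum (map f xs) + sum (map g xs)
  sum-map-+ f g []       = refl
  sum-map-+ f g (x ∷ xs) rewrite sum-map-+ f g xs = interchange (f x) (g x) (sum (map f xs)) (sum (map g xs))

  sum-map-*ʳ : ∀ {A : Set} (f : A → ℕ) c xs → sum (map (λ x → f x * c) xs) ≡ sum (map f xs) * c
  sum-map-*ʳ f c []       = refl
  sum-map-*ʳ f c (x ∷ xs) = trans (cong (f x * c +_) (sum-map-*ʳ f c xs)) (sym (*-distribʳ-+ c (f x) _))

  sum-map-zero : ∀ {A : Set} (xs : List A) → sum (map (λ _ → 0) xs) ≡ 0
  sum-map-zero []       = refl
  sum-map-zero (_ ∷ xs) = sum-map-zero xs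

  sum-map-swap : ∀ {A B : Set} (f : A → B → ℕ) xs ys →
                 sum (map (λ x → sum (map (f x) ys)) xs) ≡ sum (map (λ y → sum (map (λ x → f x y) xs)) ys)
  sum-map-swap f []       ys = sym (sum-map-zero ys)
  sum-map-swap f (x ∷ xs) ys = trans (cong (sum (map (f x) ys) +_) (sum-map-swap f xs ys))
                                     (sym (sum-map-+ (f x) (λ y → sum (map (λ x → f x y) xs)) ys))

  sum-upTo-indicator : ∀ D c k (F : ℕ → ℕ) →
                       sum (map (λ i → b2n (D ∧ (c ≡ᵇ i)) * F i) (upTo (suc k))) ≡ b2n (D ∧ (c ≤ᵇ k)) * F c
  sum-upTo-indicator false c k F = sum-map-zero (upTo (suc k))
  sum-upTo-indicator true  c k F =
    trans (cong sum (map-applyUpTo (λ i → i) (λ i → b2n (c ≡ᵇ i) * F i) (suc k))) (go c k F)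
    where
    sum-applyUpTo-zero : ∀ k → sum (applyUpTo (λ _ → 0) k) ≡ 0
    sum-applyUpTo-zero zero    = refl
    sum-applyUpTo-zero (suc k) = sum-applyUpTo-zero k
    go : ∀ c k (F : ℕ → ℕ) → sum (applyUpTo (λ i → b2n (c ≡ᵇ i) * F i) (suc k)) ≡ b2n (c ≤ᵇ k) * F c
    go zero    k       F = trans (cong (F 0 + 0 +_) (sum-applyUpTo-zero k)) (+-identityʳ _)
    go (suc c) zero    F = refl
    go (suc c) (suc k) F = trans (go c k (F ∘ suc)) (cong (λ b → b2n b * F (suc c)) (sym (<ᵇ-suc c k)))

  length-filterᵇ≡sum : ∀ {A : Set} (P : A → Bool) xs → length (filterᵇ P xs) ≡ sum (map (b2n ∘ P) xs)
  length-filterᵇ≡sum P []       = refl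
  length-filterᵇ≡sum P (x ∷ xs) with P x
  ... | true  = cong suc (length-filterᵇ≡sum P xs)
  ... | false = length-filterᵇ≡sum P xs

  length-filterᵇ-map : ∀ {A B : Set} (P : B → Bool) (g : A → B) xs →
                       length (filterᵇ P (map g xs)) ≡ length (filterᵇ (P ∘ g) xs)
  length-filterᵇ-map P g []       = refl
  length-filterᵇ-map P g (x ∷ xs) with P (g x)
  ... | true  = cong suc (length-filterᵇ-map P g xs)
  ... | false = length-filterᵇ-map P g xs

  all-↭ : ∀ {A : Set} (p : A → Bool) {xs ys} → xs ↭ ys → all p xs ≡ all p ys
  all-↭ p xs↭ys = T-≡ext (all-resp xs↭ys) (all-resp (↭-sym xs↭ys))
    where
    all-resp : ∀ {xs ys} → xs ↭ ys → T (all p xs) → T (all p ys)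
    all-resp {xs} xs↭ys t = all⁻ p (All-resp-↭ xs↭ys (all⁺ p xs t))

  removeAt-↭ : ∀ {A : Set} (xs : List A) i → xs ↭ lookup xs i ∷ removeAt xs i
  removeAt-↭ (x ∷ xs) fzero    = ↭-refl
  removeAt-↭ (x ∷ xs) (fsuc i) = ↭.trans (prep x (removeAt-↭ xs i)) (swap x _ ↭-refl)

  countFin : ∀ {n} → (Fin n → Bool) → ℕ
  countFin {zero}  P = 0
  countFin {suc n} P = b2n (P fzero) + countFin (P ∘ fsuc)

  length-filterᵇ-tabulate : ∀ {A : Set} {n} (P : A → Bool) (f : Fin n → A) →
                            length (filterᵇ P (tabulate f)) ≡ countFin (P ∘ f)
  length-filterᵇ-tabulate {n = zero}  P f = refl
  length-filterᵇ-tabulate {n = suc n} P f with P (f fzero)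
  ... | true  = cong suc (length-filterᵇ-tabulate P (f ∘ fsuc))
  ... | false = length-filterᵇ-tabulate P (f ∘ fsuc)

  countFin-cong : ∀ {n} {P Q : Fin n → Bool} → (∀ i → P i ≡ Q i) → countFin P ≡ countFin Q
  countFin-cong {zero}  P≡Q = refl
  countFin-cong {suc n} P≡Q = cong₂ _+_ (cong b2n (P≡Q fzero)) (countFin-cong (P≡Q ∘ fsuc))

  countFin-full : ∀ {n} {P : Fin n → Bool} → (∀ i → T (P i)) → countFin P ≡ n
  countFin-full {zero}            all-P = refl
  countFin-full {suc n} {P} all-P with P fzero | all-P fzero
  ... | true | _ = cong suc (countFin-full (all-P ∘ fsuc))

  countFin-mono : ∀ {n} (P Q : Fin n → Bool) → (∀ i → T (P i) → T (Q i)) → countFin P ≤ countFin Q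
  countFin-mono {zero}  P Q P⊆Q = z≤n
  countFin-mono {suc n} P Q P⊆Q with P fzero | Q fzero | P⊆Q fzero
  ... | true  | true  | _   = s≤s (countFin-mono (P ∘ fsuc) (Q ∘ fsuc) (P⊆Q ∘ fsuc))
  ... | true  | false | P⇒Q = ⊥-elim (P⇒Q tt)
  ... | false | true  | _   = m≤n⇒m≤1+n (countFin-mono (P ∘ fsuc) (Q ∘ fsuc) (P⊆Q ∘ fsuc))
  ... | false | false | _   = countFin-mono (P ∘ fsuc) (Q ∘ fsuc) (P⊆Q ∘ fsuc)

  countFin-≤ : ∀ {n} (P : Fin n → Bool) → countFin P ≤ n
  countFin-≤ P = subst (countFin P ≤_) (countFin-full {P = λ _ → true} (λ _ → tt))
                       (countFin-mono P (λ _ → true) (λ _ _ → tt))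

  countFin-pos : ∀ {n} (P : Fin n → Bool) z → T (P z) → 0 < countFin P
  countFin-pos P fzero    Pz with P fzero
  ... | true = s≤s z≤n
  countFin-pos P (fsuc z) Pz with P fzero
  ... | true  = s≤s z≤n
  ... | false = countFin-pos (P ∘ fsuc) z Pz

  countFin-mono-< : ∀ {n} (P Q : Fin n → Bool) → (∀ i → T (P i) → T (Q i)) →
                    ∀ z → ¬ T (P z) → T (Q z) → countFin P < countFin Q
  countFin-mono-< P Q P⊆Q fzero ¬Pz Qz with P fzero | Q fzero
  ... | false | true = s≤s (countFin-mono (P ∘ fsuc) (Q ∘ fsuc) (P⊆Q ∘ fsuc))
  ... | true  | _    = ⊥-elim (¬Pz tt)
  countFin-mono-< P Q P⊆Q (fsuc z) ¬Pz Qz with P fzero | Q fzero | P⊆Q fzero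
  ... | true  | true  | _   = s≤s (countFin-mono-< (P ∘ fsuc) (Q ∘ fsuc) (P⊆Q ∘ fsuc) z ¬Pz Qz)
  ... | true  | false | P⇒Q = ⊥-elim (P⇒Q tt)
  ... | false | true  | _   = m≤n⇒m≤1+n (countFin-mono-< (P ∘ fsuc) (Q ∘ fsuc) (P⊆Q ∘ fsuc) z ¬Pz Qz)
  ... | false | false | _   = countFin-mono-< (P ∘ fsuc) (Q ∘ fsuc) (P⊆Q ∘ fsuc) z ¬Pz Qz

  countFin-insert : ∀ {n} (P Q : Fin n → Bool) z → (∀ i → i ≢ z → P i ≡ Q i) →
                    ¬ T (P z) → T (Q z) → suc (countFin P) ≡ countFin Q
  countFin-insert P Q fzero    P≡Q ¬Pz Qz with P fzero | Q fzero
  ... | false | true = cong suc (countFin-cong (λ i → P≡Q (fsuc i) λ ()))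
  ... | true  | _    = ⊥-elim (¬Pz tt)
  countFin-insert P Q (fsuc z) P≡Q ¬Pz Qz rewrite P≡Q fzero (λ ()) =
    trans (sym (+-suc (b2n (Q fzero)) _))
          (cong (b2n (Q fzero) +_) (countFin-insert (P ∘ fsuc) (Q ∘ fsuc) z
            (λ i i≢z → P≡Q (fsuc i) (i≢z ∘ Fin.suc-injective)) ¬Pz Qz))

  -- Connectivity

  Adj : ∀ {n} → Graph n → Fin n → Fin n → Set
  Adj H x y = (x , y) ∈ H ⊎ (y , x) ∈ H

  Walk : ∀ {n} → Graph n → Fin n → Fin n → Set
  Walk H = Star (Adj H)

  Adj-sym : ∀ {n} {H : Graph n} {x y} → Adj H x y → Adj H y x
  Adj-sym (inj₁ xy) = inj₂ xy
  Adj-sym (inj₂ yx) = inj₁ yx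

  walk-sym : ∀ {n} {H : Graph n} {x y} → Walk H x y → Walk H y x
  walk-sym = Star.reverse Adj-sym

  walk-edge : ∀ {n} {H : Graph n} {x y} → Adj H x y → Walk H x y
  walk-edge a = a ◅ ε

  walk-mono : ∀ {n} {H H′ : Graph n} → (∀ {e} → e ∈ H → e ∈ H′) → ∀ {x y} → Walk H x y → Walk H′ x y
  walk-mono H⊆H′ = Star.map λ where
    (inj₁ xy) → inj₁ (H⊆H′ xy)
    (inj₂ yx) → inj₂ (H⊆H′ yx)

  walk-[] : ∀ {n} {x y : Fin n} → Walk [] x y → x ≡ y
  walk-[] ε               = refl
  walk-[] (inj₁ () ◅ _)
  walk-[] (inj₂ () ◅ _)

  isolated-walk : ∀ {n} {H : Graph n} {a y} → (∀ p → ¬ Adj H a p) → Walk H a y → a ≡ y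
  isolated-walk isolated ε       = refl
  isolated-walk isolated (e ◅ _) = ⊥-elim (isolated _ e)

  reach⇒walk : ∀ {n} (H : Graph n) s {x y} → T (reach H s x y) → Walk H x y
  reach⇒walk H zero r = subst (Walk H _) (==⇒≡ r) ε
  reach⇒walk H (suc s) r with to T-∨ r
  ... | inj₁ r′ = reach⇒walk H s r′
  ... | inj₂ step with find (any⁻ _ H step)
  ... | (a , b) , ab∈H , fwd-or-bwd with to T-∨ fwd-or-bwd
  ... | inj₁ fwd = let r′ , b≡y = to T-∧ fwd in
    reach⇒walk H s r′ ◅◅ walk-edge (subst (λ y → Adj H a y) (==⇒≡ b≡y) (inj₁ ab∈H))
  ... | inj₂ bwd = let r′ , a≡y = to T-∧ bwd in
    reach⇒walk H s r′ ◅◅ walk-edge (subst (λ y → Adj H b y) (==⇒≡ a≡y) (inj₂ ab∈H))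

  reach-step : ∀ {n} (H : Graph n) s {x a y} → T (reach H s x a) → Adj H a y → T (reach H (suc s) x y)
  reach-step H s r (inj₁ ay∈H) =
    from T-∨ (inj₂ (any⁺ _ (lose ay∈H (from T-∨ (inj₁ (from T-∧ (r , ≡⇒== refl)))))))
  reach-step H s r (inj₂ ya∈H) =
    from T-∨ (inj₂ (any⁺ _ (lose ya∈H (from T-∨ (inj₂ (from T-∧ (r , ≡⇒== refl)))))))

  walk⇒reach : ∀ {n} (H : Graph n) s {x a y} → T (reach H s x a) → Walk H a y → ∃[ t ] T (reach H t x y)
  walk⇒reach H s r ε = s , r
  walk⇒reach H s r (adj ◅ w) = walk⇒reach H (suc s) (reach-step H s r adj) w

  module Reachability {n} (H : Graph n) (x : Fin n) where

    R : ℕ → Fin n → Bool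
    R s = reach H s x

    R-suc : ∀ s y → T (R s y) → T (R (suc s) y)
    R-suc s y r = from T-∨ (inj₁ r)

    Stable : ℕ → Set
    Stable s = ∀ y → R (suc s) y ≡ R s y

    extends : ℕ → Fin n → Fin n × Fin n → Bool
    extends s y (a , b) = (R s a ∧ (b == y)) ∨ (R s b ∧ (a == y))

    -- R (suc s) is computed from R s alone, so once R stops growing it stays constant.
    stable-suc : ∀ s → Stable s → Stable (suc s)
    stable-suc s st y = cong₂ _∨_ (st y) (cong or (map-cong step H))
      where
      step : ∀ ab → extends (suc s) y ab ≡ extends s y ab
      step (a , b) = cong₂ _∨_ (cong (_∧ (b == y)) (st a)) (cong (_∧ (a == y)) (st b))

    stable-≤ : ∀ t → Stable t → ∀ {k} y → t ≤ k → R k y ≡ R t y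
    stable-≤ t st y t≤k with m≤n⇒∃[o]m+o≡n t≤k
    ... | o , refl = trans (cong (λ k → R k y) (+-comm t o)) (go o)
      where
      stable-+ : ∀ o → Stable (o + t)
      stable-+ zero    = st
      stable-+ (suc o) = stable-suc (o + t) (stable-+ o)
      go : ∀ o → R (o + t) y ≡ R t y
      go zero    = refl
      go (suc o) = trans (stable-+ o y) (go o)

    stable-or-growing : ∀ s → (∃[ t ] t ≤ s × Stable t) ⊎ (s < countFin (R s))
    stable-or-growing zero = inj₂ (countFin-pos (R 0) x (≡⇒== refl))
    stable-or-growing (suc s) with stable-or-growing s
    ... | inj₁ (t , t≤s , st) = inj₁ (t , m≤n⇒m≤1+n t≤s , st)
    ... | inj₂ grows with any? (λ y → T? (R (suc s) y) ×-dec ¬? (T? (R s y)))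
    ...   | yes (y , new , ¬old) =
      inj₂ (≤-trans (s≤s grows) (countFin-mono-< (R s) (R (suc s)) (R-suc s) y ¬old new))
    ...   | no  nothing-new = inj₁ (s , n≤1+n s , λ y → T-≡ext
      (λ new → decidable-stable (T? (R s y)) (λ ¬old → nothing-new (y , new , ¬old)))
      (R-suc s y))

    stabilises : ∃[ t ] t ≤ n × Stable t
    stabilises with stable-or-growing n
    ... | inj₁ stable  = stable
    ... | inj₂ n<count = ⊥-elim (<-irrefl refl (≤-trans n<count (countFin-≤ (R n))))

    reach-mono : ∀ {s t} y → s ≤ t → T (R s y) → T (R t y)
    reach-mono {s} y s≤t r with m≤n⇒∃[o]m+o≡n s≤t
    ... | o , refl = subst (λ k → T (R k y)) (+-comm o s) (go o)
      where
      go : ∀ o → T (R (o + s) y)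
      go zero    = r
      go (suc o) = R-suc (o + s) y (go o)

    reach⇒reach-n : ∀ s y → T (R s y) → T (R n y)
    reach⇒reach-n s y r with s ≤? n | stabilises
    ... | yes s≤n | _            = reach-mono y s≤n r
    ... | no  s≰n | t , t≤n , st =
      subst T (trans (stable-≤ t st y (≤-trans t≤n (<⇒≤ (≰⇒> s≰n)))) (sym (stable-≤ t st y t≤n))) r

  T-connected : ∀ {n} (H : Graph n) x y → T (connected H x y) ⇔ Walk H x y
  T-connected {n} H x y = mk⇔ (reach⇒walk H n) λ w →
    let s , r = walk⇒reach H 0 (≡⇒== refl) w in Reachability.reach⇒reach-n H x s y r

  walk? : ∀ {n} (H : Graph n) x y → Dec (Walk H x y)
  walk? H x y = Dec.map (T-connected H x y) (T? (connected H x y))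

  isRoot : ∀ {n} → Graph n → Fin n → Bool
  isRoot {n} H v = not (any (λ u → (toℕ u <ᵇ toℕ v) ∧ connected H u v) (allFin n))

  IsRoot : ∀ {n} → Graph n → Fin n → Set
  IsRoot H v = ∀ u → toℕ u < toℕ v → ¬ Walk H u v

  components≡countFin-isRoot : ∀ {n} (H : Graph n) → components H ≡ countFin (isRoot H)
  components≡countFin-isRoot H = length-filterᵇ-tabulate (isRoot H) (λ v → v)

  T-isRoot : ∀ {n} (H : Graph n) v → T (isRoot H v) ⇔ IsRoot H v
  T-isRoot {n} H v with any (λ u → (toℕ u <ᵇ toℕ v) ∧ connected H u v) (allFin n) in eq
  ... | true  = mk⇔ (λ ()) λ root →
    let u , t = to (T-any-allFin _) (subst T (sym eq) tt)
        u<v , c = to T-∧ t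
    in root u (<ᵇ⇒< _ _ u<v) (to (T-connected H u v) c)
  ... | false = mk⇔ (λ _ u u<v w → subst T eq (from (T-any-allFin _)
    (u , from T-∧ (<⇒<ᵇ u<v , from (T-connected H u v) w)))) (λ _ → tt)

  components-cong : ∀ {n} (H H′ : Graph n) → (∀ {x y} → Walk H x y → Walk H′ x y) →
                    (∀ {x y} → Walk H′ x y → Walk H x y) → components H ≡ components H′
  components-cong H H′ H⇒H′ H′⇒H = begin
    components H         ≡⟨ components≡countFin-isRoot H ⟩
    countFin (isRoot H)  ≡⟨ countFin-cong (λ v → T-≡ext (root⇒root H′⇒H v) (root⇒root H⇒H′ v)) ⟩
    countFin (isRoot H′) ≡⟨ components≡countFin-isRoot H′ ⟨
    components H′        ∎
    where
    root⇒root : ∀ {K K′} → (∀ {x y} → Walk K′ x y → Walk K x y) → ∀ v → T (isRoot K v) → T (isRoot K′ v)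
    root⇒root {K} {K′} K′⇒K v r = from (T-isRoot K′ v) λ u u<v w → to (T-isRoot K v) r u u<v (K′⇒K w)

  components-[] : ∀ {n} → components {n} [] ≡ n
  components-[] {n} = trans (components≡countFin-isRoot {n} [])
    (countFin-full λ v → from (T-isRoot [] v) λ u u<v w → <-irrefl (cong toℕ (walk-[] w)) u<v)

  components-↭ : ∀ {n} {H H′ : Graph n} → H ↭ H′ → components H ≡ components H′
  components-↭ H↭H′ = components-cong _ _ (walk-mono (∈-resp-↭ H↭H′)) (walk-mono (∈-resp-↭ (↭-sym H↭H′)))

  roots-unique : ∀ {n} {H : Graph n} {r r′} → IsRoot H r → IsRoot H r′ → Walk H r r′ → r ≡ r′
  roots-unique {r = r} {r′} root root′ w with <-cmp (toℕ r) (toℕ r′)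
  ... | tri< r<r′ _ _ = ⊥-elim (root′ r r<r′ w)
  ... | tri≈ _ r≡r′ _ = toℕ-injective r≡r′
  ... | tri> _ _ r′<r = ⊥-elim (root r′ r′<r (walk-sym w))

  root-minimal : ∀ {n} {H : Graph n} {r u} → IsRoot H r → Walk H u r → toℕ r ≤ toℕ u
  root-minimal {r = r} {u} root w with toℕ r ≤? toℕ u
  ... | yes r≤u = r≤u
  ... | no  r≰u = ⊥-elim (root u (≰⇒> r≰u) w)

  root-exists : ∀ {n} (H : Graph n) w → ∃[ r ] IsRoot H r × Walk H r w
  root-exists H w = go (suc (toℕ w)) w ≤-refl
    where
    go : ∀ bound v → toℕ v < bound → ∃[ r ] IsRoot H r × Walk H r v
    go (suc bound) v v<bound with isRoot H v in eq
    ... | true  = v , to (T-isRoot H v) (subst T (sym eq) tt) , ε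
    ... | false =
      let u , u<v , c = decidable-stable (any? λ u → toℕ u <? toℕ v ×-dec T? (connected H u v)) λ ¬smaller →
                          subst T eq (from (T-isRoot H v) λ u u<v w → ¬smaller (u , u<v , from (T-connected H u v) w))
          r , root , w = go bound u (<-≤-trans u<v (≤-pred v<bound))
      in r , root , w ◅◅ to (T-connected H u v) c

  components-∷-walk : ∀ {n} (K : Graph n) {a b} → Walk K a b → components ((a , b) ∷ K) ≡ components K
  components-∷-walk K {a} {b} w = components-cong _ K (step ⋆) (walk-mono there)
    where
    step : ∀ {x y} → Adj ((a , b) ∷ K) x y → Walk K x y
    step (inj₁ (here refl)) = w
    step (inj₂ (here refl)) = walk-sym w
    step (inj₁ (there xy))  = walk-edge (inj₁ xy)
    step (inj₂ (there yx))  = walk-edge (inj₂ yx)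

  SplitWalk : ∀ {n} → Graph n → Fin n → Fin n → Fin n → Fin n → Set
  SplitWalk K a b x y = Walk K x y ⊎ (Walk K x a × Walk K b y) ⊎ (Walk K x b × Walk K a y)

  split-◅ : ∀ {n} {K : Graph n} {a b x z y} → Adj K x z → SplitWalk K a b z y → SplitWalk K a b x y
  split-◅ e (inj₁ w)              = inj₁ (e ◅ w)
  split-◅ e (inj₂ (inj₁ (w , v))) = inj₂ (inj₁ (e ◅ w , v))
  split-◅ e (inj₂ (inj₂ (w , v))) = inj₂ (inj₂ (e ◅ w , v))

  walk-∷-split : ∀ {n} {K : Graph n} {a b x y} → Walk ((a , b) ∷ K) x y → SplitWalk K a b x y
  walk-∷-split ε       = inj₁ ε
  walk-∷-split (e ◅ w) = prepend e (walk-∷-split w)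
    where
    prepend : ∀ {n} {K : Graph n} {a b x z y} → Adj ((a , b) ∷ K) x z → SplitWalk K a b z y → SplitWalk K a b x y
    prepend (inj₁ (here refl)) (inj₁ w)              = inj₂ (inj₁ (ε , w))
    prepend (inj₁ (here refl)) (inj₂ (inj₁ (_ , w))) = inj₂ (inj₁ (ε , w))
    prepend (inj₁ (here refl)) (inj₂ (inj₂ (_ , w))) = inj₁ w
    prepend (inj₂ (here refl)) (inj₁ w)              = inj₂ (inj₂ (ε , w))
    prepend (inj₂ (here refl)) (inj₂ (inj₁ (_ , w))) = inj₁ w
    prepend (inj₂ (here refl)) (inj₂ (inj₂ (_ , w))) = inj₂ (inj₂ (ε , w))
    prepend (inj₁ (there xz))  w                     = split-◅ (inj₁ xz) w
    prepend (inj₂ (there zx))  w                     = split-◅ (inj₂ zx) w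

  components-bridge : ∀ {n} (K : Graph n) {a b ra rb} → IsRoot K ra → Walk K ra a → IsRoot K rb → Walk K rb b →
                      toℕ ra < toℕ rb → suc (components ((a , b) ∷ K)) ≡ components K
  components-bridge {n} K {a} {b} {ra} {rb} root-a wa root-b wb ra<rb = begin
    suc (components K′)        ≡⟨ cong suc (components≡countFin-isRoot K′) ⟩
    suc (countFin (isRoot K′)) ≡⟨ countFin-insert (isRoot K′) (isRoot K) rb same rb-not-root (from (T-isRoot K rb) root-b) ⟩
    countFin (isRoot K)        ≡⟨ components≡countFin-isRoot K ⟨
    components K               ∎
    where
    K′ : Graph n
    K′ = (a , b) ∷ K
    rb-not-root : ¬ T (isRoot K′ rb)
    rb-not-root r = to (T-isRoot K′ rb) r ra ra<rb
      (walk-mono there wa ◅◅ walk-edge (inj₁ (here refl)) ◅◅ walk-mono there (walk-sym wb))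
    same : ∀ v → v ≢ rb → isRoot K′ v ≡ isRoot K v
    same v v≢rb = T-≡ext
      (λ r → from (T-isRoot K v) λ u u<v w → to (T-isRoot K′ v) r u u<v (walk-mono there w))
      (λ r → from (T-isRoot K′ v) λ u u<v w → no-split (to (T-isRoot K v) r) u u<v (walk-∷-split w))
      where
      no-split : IsRoot K v → ∀ u → toℕ u < toℕ v → ¬ SplitWalk K a b u v
      no-split root u u<v (inj₁ w)              = root u u<v w
      no-split root u u<v (inj₂ (inj₁ (_ , w))) = v≢rb (sym (roots-unique root-b root (wb ◅◅ w)))
      no-split root u u<v (inj₂ (inj₂ (w , v′))) with roots-unique root-a root (wa ◅◅ v′)
      ... | refl = <-irrefl refl (<-≤-trans u<v (<⇒≤ (<-≤-trans ra<rb (root-minimal root-b (w ◅◅ walk-sym wb)))))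

  flip-edge : ∀ {n} {K : Graph n} {a b x y} → Adj ((a , b) ∷ K) x y → Adj ((b , a) ∷ K) x y
  flip-edge (inj₁ (here refl)) = inj₂ (here refl)
  flip-edge (inj₂ (here refl)) = inj₁ (here refl)
  flip-edge (inj₁ (there xy))  = inj₁ (there xy)
  flip-edge (inj₂ (there yx))  = inj₂ (there yx)

  components-∷-¬walk : ∀ {n} (K : Graph n) {a b} → ¬ Walk K a b → suc (components ((a , b) ∷ K)) ≡ components K
  components-∷-¬walk K {a} {b} ¬w with root-exists K a | root-exists K b
  ... | ra , root-a , wa | rb , root-b , wb with <-cmp (toℕ ra) (toℕ rb)
  ... | tri< ra<rb _ _ = components-bridge K root-a wa root-b wb ra<rb
  ... | tri≈ _ ra≡rb _ = ⊥-elim (¬w (walk-sym wa ◅◅ subst (λ r → Walk K r b) (sym (toℕ-injective ra≡rb)) wb))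
  ... | tri> _ _ rb<ra = trans (cong suc (components-cong ((a , b) ∷ K) ((b , a) ∷ K) (Star.map flip-edge) (Star.map flip-edge)))
                               (components-bridge K root-b wb root-a wa rb<ra)

  twoRegular : ∀ {n} → Graph n → Bool
  twoRegular {n} H = all (λ w → deg H w ≡ᵇ 2) (allFin n)

  twoRegularOff : ∀ {n} → Graph n → Fin n → Fin n → Bool
  twoRegularOff {n} H a b = all (λ c → (c == a) ∨ (c == b) ∨ (deg H c ≡ᵇ 2)) (allFin n)

  T-twoRegular : ∀ {n} (H : Graph n) → T (twoRegular H) ⇔ (∀ c → deg H c ≡ 2)
  T-twoRegular H = mk⇔ (λ t c → ≡ᵇ⇒≡ _ 2 (to (T-all-allFin deg2) t c))
                       (λ d → from (T-all-allFin deg2) λ c → ≡⇒≡ᵇ _ 2 (d c))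
    where
    deg2 : Fin _ → Bool
    deg2 c = deg H c ≡ᵇ 2

  T-twoRegularOff : ∀ {n} (H : Graph n) a b → T (twoRegularOff H a b) ⇔ (∀ c → c ≢ a → c ≢ b → deg H c ≡ 2)
  T-twoRegularOff H a b = mk⇔
    (λ t c c≢a c≢b → off⇒deg2 c c≢a c≢b (to (T-all-allFin off) t c))
    (λ d → from (T-all-allFin off) λ c → deg2⇒off c (c ≟ a) (c ≟ b) d)
    where
    off : Fin _ → Bool
    off c = (c == a) ∨ (c == b) ∨ (deg H c ≡ᵇ 2)
    off⇒deg2 : ∀ c → c ≢ a → c ≢ b → T (off c) → deg H c ≡ 2
    off⇒deg2 c c≢a c≢b t rewrite ==-≢ c≢a | ==-≢ c≢b = ≡ᵇ⇒≡ _ 2 t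
    deg2⇒off : ∀ c → Dec (c ≡ a) → Dec (c ≡ b) → (∀ c → c ≢ a → c ≢ b → deg H c ≡ 2) → T (off c)
    deg2⇒off c (yes c≡a) _         d = from (T-∨ {c == a}) (inj₁ (≡⇒== c≡a))
    deg2⇒off c (no  _)   (yes c≡b) d = from (T-∨ {c == a}) (inj₂ (from (T-∨ {c == b}) (inj₁ (≡⇒== c≡b))))
    deg2⇒off c (no  c≢a) (no  c≢b) d =
      from (T-∨ {c == a}) (inj₂ (from (T-∨ {c == b}) (inj₂ (≡⇒≡ᵇ _ 2 (d c c≢a c≢b)))))

  module _ {n} (H : Graph n) {u v : Fin n} (u≢v : u ≢ v) where

    deg-∷-src : deg ((u , v) ∷ H) u ≡ suc (deg H u)
    deg-∷-src rewrite ==-refl u | ==-≢ (u≢v ∘ sym) = refl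

    deg-∷-tgt : deg ((u , v) ∷ H) v ≡ suc (deg H v)
    deg-∷-tgt rewrite ==-refl v | ==-≢ u≢v = refl

    deg-∷-other : ∀ c → c ≢ u → c ≢ v → deg ((u , v) ∷ H) c ≡ deg H c
    deg-∷-other c c≢u c≢v rewrite ==-≢ (c≢u ∘ sym) | ==-≢ (c≢v ∘ sym) = refl

    twoRegular-∷ : twoRegular ((u , v) ∷ H) ≡ (deg H u ≡ᵇ 1) ∧ (deg H v ≡ᵇ 1) ∧ twoRegularOff H u v
    twoRegular-∷ = T-≡ext
      (λ t → let d = to (T-twoRegular ((u , v) ∷ H)) t in
        from (T-∧ {deg H u ≡ᵇ 1}) (≡⇒≡ᵇ _ 1 (suc-injective (trans (sym deg-∷-src) (d u))) ,
        from (T-∧ {deg H v ≡ᵇ 1}) (≡⇒≡ᵇ _ 1 (suc-injective (trans (sym deg-∷-tgt) (d v))) ,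
        from (T-twoRegularOff H u v) λ c c≢u c≢v → trans (sym (deg-∷-other c c≢u c≢v)) (d c))))
      (λ t → let du , t′ = to (T-∧ {deg H u ≡ᵇ 1}) t; dv , off = to (T-∧ {deg H v ≡ᵇ 1}) t′ in
        from (T-twoRegular ((u , v) ∷ H)) λ c →
          case-split c (≡ᵇ⇒≡ _ 1 du) (≡ᵇ⇒≡ _ 1 dv) (to (T-twoRegularOff H u v) off))
      where
      case-split : ∀ c → deg H u ≡ 1 → deg H v ≡ 1 → (∀ c → c ≢ u → c ≢ v → deg H c ≡ 2) →
                   deg ((u , v) ∷ H) c ≡ 2
      case-split c du dv off with c ≟ u | c ≟ v
      ... | yes refl | _        = trans deg-∷-src (cong suc du)
      ... | no  _    | yes refl = trans deg-∷-tgt (cong suc dv)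
      ... | no  c≢u  | no  c≢v  = trans (deg-∷-other c c≢u c≢v) (off c c≢u c≢v)

  deg-++ : ∀ {n} (H K : Graph n) w → deg (H ++ K) w ≡ deg H w + deg K w
  deg-++ []            K w = refl
  deg-++ ((s , t) ∷ H) K w =
    trans (cong (b2n (s == w) + b2n (t == w) +_) (deg-++ H K w)) (sym (+-assoc (b2n (s == w) + b2n (t == w)) _ _))

  deg-↭ : ∀ {n} {H H′ : Graph n} → H ↭ H′ → ∀ v → deg H v ≡ deg H′ v
  deg-↭ H↭H′ v = sum-↭ (map⁺ _ H↭H′)

  -- Merging two vertices

  relabel : ∀ {n m} → (Fin n → Fin m) → Graph n → Graph m
  relabel f = map (λ ab → f (proj₁ ab) , f (proj₂ ab))

  relabel-↭ : ∀ {n m} (f : Fin n → Fin m) {H H′} → H ↭ H′ → relabel f H ↭ relabel f H′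
  relabel-↭ f = map⁺ (λ ab → f (proj₁ ab) , f (proj₂ ab))

  record IsMerge {n} (f : Fin (suc n) → Fin n) (a b : Fin (suc n)) : Set where
    field
      a≢b        : a ≢ b
      fa≡fb      : f a ≡ f b
      identifies : ∀ c d → f c ≡ f d → c ≢ d → (c ≡ a × d ≡ b) ⊎ (c ≡ b × d ≡ a)
      surjective : ∀ w → ∃[ c ] f c ≡ w

  IsMerge-sym : ∀ {n} {f : Fin (suc n) → Fin n} {a b} → IsMerge f a b → IsMerge f b a
  IsMerge-sym M = record
    { a≢b        = a≢b ∘ sym
    ; fa≡fb      = sym fa≡fb
    ; identifies = λ c d fc≡fd c≢d → Sum.swap (identifies c d fc≡fd c≢d)
    ; surjective = surjective
    }
    where open IsMerge M

  merge-≢ : ∀ {n} {u v : Fin (suc n)} (u≢v : u ≢ v) w (v≢w : v ≢ w) → merge u≢v w ≡ punchOut v≢w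
  merge-≢ {v = v} u≢v w v≢w with v ≟ w
  ... | yes v≡w = ⊥-elim (v≢w v≡w)
  ... | no  _   = punchOut-cong v refl

  merge-v : ∀ {n} {u v : Fin (suc n)} (u≢v : u ≢ v) → merge u≢v v ≡ punchOut (u≢v ∘ sym)
  merge-v {v = v} u≢v with v ≟ v
  ... | yes _   = refl
  ... | no  v≢v = ⊥-elim (v≢v refl)

  merge-isMerge : ∀ {n} {u v : Fin (suc n)} (u≢v : u ≢ v) → IsMerge (merge u≢v) u v
  merge-isMerge {u = u} {v} u≢v = record
    { a≢b        = u≢v
    ; fa≡fb      = trans (merge-≢ u≢v u (u≢v ∘ sym)) (sym (merge-v u≢v))
    ; identifies = identifies
    ; surjective = λ w → punchIn v w ,
        trans (merge-≢ u≢v (punchIn v w) (punchInᵢ≢i v w ∘ sym)) (punchOut-punchIn v)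
    }
    where
    identifies : ∀ c d → merge u≢v c ≡ merge u≢v d → c ≢ d → (c ≡ u × d ≡ v) ⊎ (c ≡ v × d ≡ u)
    identifies c d eq c≢d = cases (v ≟ c) (v ≟ d)
      where
      cases : Dec (v ≡ c) → Dec (v ≡ d) → (c ≡ u × d ≡ v) ⊎ (c ≡ v × d ≡ u)
      cases (yes refl) (yes refl) = ⊥-elim (c≢d refl)
      cases (yes refl) (no  v≢d)  = inj₂ (refl , sym (punchOut-injective (u≢v ∘ sym) v≢d
                                      (trans (sym (merge-v u≢v)) (trans eq (merge-≢ u≢v d v≢d)))))
      cases (no  v≢c)  (yes refl) = inj₁ (punchOut-injective v≢c (u≢v ∘ sym)
                                      (trans (sym (merge-≢ u≢v c v≢c)) (trans eq (merge-v u≢v))) , refl)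
      cases (no  v≢c)  (no  v≢d)  = ⊥-elim (c≢d (punchOut-injective v≢c v≢d
                                      (trans (sym (merge-≢ u≢v c v≢c)) (trans eq (merge-≢ u≢v d v≢d)))))

  module Merge {n} {f : Fin (suc n) → Fin n} {a b : Fin (suc n)} (M : IsMerge f a b) where
    open IsMerge M

    glued : ∀ H {c d} → f c ≡ f d → Walk ((a , b) ∷ H) c d
    glued H {c} {d} fc≡fd with c ≟ d
    ... | yes refl = ε
    ... | no  c≢d with identifies c d fc≡fd c≢d
    ...   | inj₁ (refl , refl) = walk-edge (inj₁ (here refl))
    ...   | inj₂ (refl , refl) = walk-edge (inj₂ (here refl))

    walk-relabel : ∀ H {c d} → Walk ((a , b) ∷ H) c d → Walk (relabel f H) (f c) (f d)
    walk-relabel H ε                      = ε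
    walk-relabel H (inj₁ (here refl) ◅ w) = subst (λ z → Walk (relabel f H) z (f _)) (sym fa≡fb) (walk-relabel H w)
    walk-relabel H (inj₂ (here refl) ◅ w) = subst (λ z → Walk (relabel f H) z (f _)) fa≡fb (walk-relabel H w)
    walk-relabel H (inj₁ (there e) ◅ w)   = inj₁ (∈-map⁺ _ e) ◅ walk-relabel H w
    walk-relabel H (inj₂ (there e) ◅ w)   = inj₂ (∈-map⁺ _ e) ◅ walk-relabel H w

    walk-unrelabel : ∀ H {w₁ w₂} → Walk (relabel f H) w₁ w₂ →
                     ∀ {c d} → f c ≡ w₁ → f d ≡ w₂ → Walk ((a , b) ∷ H) c d
    walk-unrelabel H ε            fc fd = glued H (trans fc (sym fd))
    walk-unrelabel H (inj₁ e ◅ w) fc fd with ∈-map⁻ _ e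
    ... | (s , t) , st∈H , refl = glued H fc ◅◅ inj₁ (there st∈H) ◅ walk-unrelabel H w refl fd
    walk-unrelabel H (inj₂ e ◅ w) fc fd with ∈-map⁻ _ e
    ... | (s , t) , st∈H , refl = glued H fc ◅◅ inj₂ (there st∈H) ◅ walk-unrelabel H w refl fd

    components-merge : ∀ H → components ((a , b) ∷ H) ≡ components (relabel f H)
    components-merge [] = suc-injective (begin
      suc (components ((a , b) ∷ [])) ≡⟨ components-∷-¬walk [] (a≢b ∘ walk-[]) ⟩
      components {suc n} []           ≡⟨ components-[] ⟩
      suc n                           ≡⟨ cong suc components-[] ⟨
      suc (components {n} [])         ∎)
    components-merge ((p , q) ∷ H) with walk? ((a , b) ∷ H) p q
    ... | yes w = begin
      components ((a , b) ∷ (p , q) ∷ H)      ≡⟨ components-↭ (swap (a , b) (p , q) ↭-refl) ⟩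
      components ((p , q) ∷ (a , b) ∷ H)      ≡⟨ components-∷-walk _ w ⟩
      components ((a , b) ∷ H)                ≡⟨ components-merge H ⟩
      components (relabel f H)                ≡⟨ components-∷-walk _ (walk-relabel H w) ⟨
      components (relabel f ((p , q) ∷ H))    ∎
    ... | no ¬w = suc-injective (begin
      suc (components ((a , b) ∷ (p , q) ∷ H))   ≡⟨ cong suc (components-↭ (swap (a , b) (p , q) ↭-refl)) ⟩
      suc (components ((p , q) ∷ (a , b) ∷ H))   ≡⟨ components-∷-¬walk _ ¬w ⟩
      components ((a , b) ∷ H)                   ≡⟨ components-merge H ⟩
      components (relabel f H)                   ≡⟨ components-∷-¬walk _ (λ w → ¬w (walk-unrelabel H w refl refl)) ⟨
      suc (components (relabel f ((p , q) ∷ H))) ∎)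

    components-merge-isolated : ∀ H → (∀ p → ¬ Adj H a p) → components H ≡ suc (components (relabel f H))
    components-merge-isolated H isolated = begin
      components H                    ≡⟨ components-∷-¬walk H (a≢b ∘ isolated-walk isolated) ⟨
      suc (components ((a , b) ∷ H))  ≡⟨ cong suc (components-merge H) ⟩
      suc (components (relabel f H))  ∎

    ==-relabel-other : ∀ p c → c ≢ a → c ≢ b → (f p == f c) ≡ (p == c)
    ==-relabel-other p c c≢a c≢b with p ≟ c
    ... | yes refl = ==-refl (f p)
    ... | no  p≢c with f p ≟ f c
    ...   | no  _     = refl
    ...   | yes fp≡fc with identifies p c fp≡fc p≢c
    ...     | inj₁ (_ , c≡b) = ⊥-elim (c≢b c≡b)
    ...     | inj₂ (_ , c≡a) = ⊥-elim (c≢a c≡a)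

    b2n-==-merged : ∀ p → b2n (f p == f a) ≡ b2n (p == a) + b2n (p == b)
    b2n-==-merged p with p ≟ a
    ... | yes refl rewrite ==-refl (f a) | ==-≢ a≢b = refl
    ... | no  p≢a with p ≟ b
    ...   | yes refl rewrite sym fa≡fb | ==-refl (f a) = refl
    ...   | no  p≢b with f p ≟ f a
    ...     | no  _     = refl
    ...     | yes fp≡fa with identifies p a fp≡fa p≢a
    ...       | inj₁ (p≡a , _) = ⊥-elim (p≢a p≡a)
    ...       | inj₂ (p≡b , _) = ⊥-elim (p≢b p≡b)

    deg-relabel-other : ∀ H c → c ≢ a → c ≢ b → deg (relabel f H) (f c) ≡ deg H c
    deg-relabel-other []            c c≢a c≢b = refl
    deg-relabel-other ((s , t) ∷ H) c c≢a c≢b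
      rewrite ==-relabel-other s c c≢a c≢b | ==-relabel-other t c c≢a c≢b | deg-relabel-other H c c≢a c≢b = refl

    deg-relabel-merged : ∀ H → deg (relabel f H) (f a) ≡ deg H a + deg H b
    deg-relabel-merged []            = refl
    deg-relabel-merged ((s , t) ∷ H) rewrite b2n-==-merged s | b2n-==-merged t | deg-relabel-merged H =
      ℕ-Solver.solve 6 (λ sa sb ta tb ha hb → (sa :+ sb) :+ (ta :+ tb) :+ (ha :+ hb) := (sa :+ ta :+ ha) :+ (sb :+ tb :+ hb))
        refl (b2n (s == a)) (b2n (s == b)) (b2n (t == a)) (b2n (t == b)) (deg H a) (deg H b)
      where open ℕ-Solver using (_:+_; _:=_)

    twoRegular-relabel : ∀ H → twoRegular (relabel f H) ≡ (deg H a + deg H b ≡ᵇ 2) ∧ twoRegularOff H a b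
    twoRegular-relabel H = T-≡ext
      (λ t → let d = to (T-twoRegular (relabel f H)) t in
        from (T-∧ {deg H a + deg H b ≡ᵇ 2}) (≡⇒≡ᵇ _ 2 (trans (sym (deg-relabel-merged H)) (d (f a))) ,
        from (T-twoRegularOff H a b) λ c c≢a c≢b → trans (sym (deg-relabel-other H c c≢a c≢b)) (d (f c))))
      (λ t → let dab , off = to (T-∧ {deg H a + deg H b ≡ᵇ 2}) t in
        from (T-twoRegular (relabel f H)) λ w → deg2 w (≡ᵇ⇒≡ _ 2 dab) (to (T-twoRegularOff H a b) off))
      where
      deg2 : ∀ w → deg H a + deg H b ≡ 2 → (∀ c → c ≢ a → c ≢ b → deg H c ≡ 2) → deg (relabel f H) w ≡ 2
      deg2 w dab off with surjective w
      ... | c , refl with c ≟ a | c ≟ b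
      ...   | yes refl | _        = trans (deg-relabel-merged H) dab
      ...   | no  _    | yes refl = trans (cong (deg (relabel f H)) (sym fa≡fb)) (trans (deg-relabel-merged H) dab)
      ...   | no  c≢a  | no  c≢b  = trans (deg-relabel-other H c c≢a c≢b) (off c c≢a c≢b)

  avoids : ∀ {n} → Fin n → Fin n × Fin n → Bool
  avoids u (a , b) = not (u == a) ∧ not (u == b)

  deleteVertex≡relabel-filter : ∀ {n} (G : Graph (suc n)) u (g : Fin (suc n) → Fin n) →
                                (∀ w (u≢w : u ≢ w) → g w ≡ punchOut u≢w) →
                                deleteVertex G u ≡ relabel g (filterᵇ (avoids u) G)
  deleteVertex≡relabel-filter []             u g g≡punchOut = refl
  deleteVertex≡relabel-filter ((a , b) ∷ es) u g g≡punchOut with u ≟ a | u ≟ b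
  ... | no u≢a | no u≢b = cong₂ _∷_ (cong₂ _,_ (sym (g≡punchOut a u≢a)) (sym (g≡punchOut b u≢b)))
                                (deleteVertex≡relabel-filter es u g g≡punchOut)
  ... | yes _  | _      = deleteVertex≡relabel-filter es u g g≡punchOut
  ... | no _   | yes _  = deleteVertex≡relabel-filter es u g g≡punchOut

  all-avoids≡deg0 : ∀ {n} (H : Graph n) u → all (avoids u) H ≡ (deg H u ≡ᵇ 0)
  all-avoids≡deg0 []            u = refl
  all-avoids≡deg0 ((s , t) ∷ H) u
    rewrite ==-sym u s | ==-sym u t | all-avoids≡deg0 H u with s == u | t == u
  ... | true  | _     = refl
  ... | false | true  = refl
  ... | false | false = refl

  avoids⇒isolated : ∀ {n} (H : Graph n) u → T (all (avoids u) H) → ∀ p → ¬ Adj H u p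
  avoids⇒isolated H u t p (inj₁ up∈H) =
    subst (T ∘ not) (==-refl u) (proj₁ (to T-∧ (All.lookup (all⁺ (avoids u) H t) up∈H)))
  avoids⇒isolated H u t p (inj₂ pu∈H) =
    subst (T ∘ not) (==-refl u) (proj₂ (to (T-∧ {not (u == p)}) (All.lookup (all⁺ (avoids u) H t) pu∈H)))

  -- Counting spanning subgraphs

  module _ {A : Set} where

    countSub : (List A → Bool) → List A → ℕ
    countSub P L = length (filterᵇ P (subgraphs L))

    countSub-[] : ∀ P → countSub P [] ≡ b2n (P [])
    countSub-[] P with P []
    ... | true  = refl
    ... | false = refl

    countSub-∷ : ∀ P x xs → countSub P (x ∷ xs) ≡ countSub (P ∘ (x ∷_)) xs + countSub P xs
    countSub-∷ P x xs = begin
      length (filterᵇ P (map (x ∷_) S ++ S))             ≡⟨ cong length (filter-++ (T? ∘ P) (map (x ∷_) S) S) ⟩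
      length (filterᵇ P (map (x ∷_) S) ++ filterᵇ P S)   ≡⟨ length-++ (filterᵇ P (map (x ∷_) S)) ⟩
      length (filterᵇ P (map (x ∷_) S)) + countSub P xs  ≡⟨ cong (_+ _) (length-filterᵇ-map P (x ∷_) S) ⟩
      countSub (P ∘ (x ∷_)) xs + countSub P xs           ∎
      where
      S : List (List A)
      S = subgraphs xs

    countSub-cong : ∀ {P Q} xs → (∀ H → P H ≡ Q H) → countSub P xs ≡ countSub Q xs
    countSub-cong {P} {Q} xs P≡Q = cong length (filter-≐ (T? ∘ P) (T? ∘ Q)
      ((λ {H} → subst T (P≡Q H)) , (λ {H} → subst T (sym (P≡Q H)))) (subgraphs xs))

    countSub-none : ∀ {P} xs → (∀ H → ¬ T (P H)) → countSub P xs ≡ 0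
    countSub-none {P} xs ¬P = cong length (filter-none (T? ∘ P) (All.universal ¬P (subgraphs xs)))

    countSub≡sum : ∀ P xs → countSub P xs ≡ sum (map (b2n ∘ P) (subgraphs xs))
    countSub≡sum P xs = length-filterᵇ≡sum P (subgraphs xs)

    countSub-+₃ : ∀ P Q R S xs → (∀ H → b2n (P H) + b2n (Q H) + b2n (R H) ≡ b2n (S H)) →
                  countSub P xs + countSub Q xs + countSub R xs ≡ countSub S xs
    countSub-+₃ P Q R S xs pointwise = begin
      countSub P xs + countSub Q xs + countSub R xs
        ≡⟨ cong₂ _+_ (cong₂ _+_ (countSub≡sum P xs) (countSub≡sum Q xs)) (countSub≡sum R xs) ⟩
      sum (map (b2n ∘ P) Hs) + sum (map (b2n ∘ Q) Hs) + sum (map (b2n ∘ R) Hs)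
        ≡⟨ cong (_+ _) (sum-map-+ (b2n ∘ P) (b2n ∘ Q) Hs) ⟨
      sum (map (λ H → b2n (P H) + b2n (Q H)) Hs) + sum (map (b2n ∘ R) Hs)
        ≡⟨ sum-map-+ (λ H → b2n (P H) + b2n (Q H)) (b2n ∘ R) Hs ⟨
      sum (map (λ H → b2n (P H) + b2n (Q H) + b2n (R H)) Hs)
        ≡⟨ cong sum (map-cong pointwise Hs) ⟩
      sum (map (b2n ∘ S) Hs)
        ≡⟨ countSub≡sum S xs ⟨
      countSub S xs ∎
      where
      Hs : List (List A)
      Hs = subgraphs xs

    Respects-↭ : (List A → Bool) → Set
    Respects-↭ P = ∀ {H H′} → H ↭ H′ → P H ≡ P H′

    countSub-↭ : ∀ P → Respects-↭ P → ∀ {xs ys} → xs ↭ ys → countSub P xs ≡ countSub P ys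
    countSub-↭ P resp ↭.refl = refl
    countSub-↭ P resp {x ∷ xs} {.x ∷ ys} (prep x p) = trans (countSub-∷ P x xs) (trans
      (cong₂ _+_ (countSub-↭ (P ∘ (x ∷_)) (resp ∘ prep x) p) (countSub-↭ P resp p))
      (sym (countSub-∷ P x ys)))
    countSub-↭ P resp (↭.trans p q) = trans (countSub-↭ P resp p) (countSub-↭ P resp q)
    countSub-↭ P resp {x ∷ y ∷ xs} {.y ∷ .x ∷ ys} (swap x y p) = begin
      countSub P (x ∷ y ∷ xs)  ≡⟨ split P x y xs ⟩
      (countSub (λ H → P (x ∷ y ∷ H)) xs + countSub (P ∘ (x ∷_)) xs) + (countSub (P ∘ (y ∷_)) xs + countSub P xs)
        ≡⟨ cong₂ _+_ (cong₂ _+_ (trans (countSub-cong xs (λ H → resp (swap x y ↭-refl))) (perm (y ∷ x ∷ [])))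
                                (perm (x ∷ [])))
                     (cong₂ _+_ (perm (y ∷ [])) (perm [])) ⟩
      (countSub (λ H → P (y ∷ x ∷ H)) ys + countSub (P ∘ (x ∷_)) ys) + (countSub (P ∘ (y ∷_)) ys + countSub P ys)
        ≡⟨ interchange (countSub (λ H → P (y ∷ x ∷ H)) ys) _ _ (countSub P ys) ⟩
      (countSub (λ H → P (y ∷ x ∷ H)) ys + countSub (P ∘ (y ∷_)) ys) + (countSub (P ∘ (x ∷_)) ys + countSub P ys)
        ≡⟨ split P y x ys ⟨
      countSub P (y ∷ x ∷ ys)  ∎
      where
      split : ∀ P x y zs → countSub P (x ∷ y ∷ zs) ≡
              (countSub (λ H → P (x ∷ y ∷ H)) zs + countSub (P ∘ (x ∷_)) zs) + (countSub (P ∘ (y ∷_)) zs + countSub P zs)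
      split P x y zs = trans (countSub-∷ P x (y ∷ zs)) (cong₂ _+_ (countSub-∷ (P ∘ (x ∷_)) y zs) (countSub-∷ P y zs))
      perm : ∀ zs → countSub (P ∘ (zs ++_)) xs ≡ countSub (P ∘ (zs ++_)) ys
      perm zs = countSub-↭ (P ∘ (zs ++_)) (resp ∘ ++⁺ˡ zs) p

    countSub-filter : ∀ P Q xs → countSub P (filterᵇ Q xs) ≡ countSub (λ H → all Q H ∧ P H) xs
    countSub-filter P Q []       = trans (countSub-[] P) (sym (countSub-[] (λ H → all Q H ∧ P H)))
    countSub-filter P Q (x ∷ xs) with Q x in Qx
    ... | true  = begin
      countSub P (x ∷ filterᵇ Q xs)                                          ≡⟨ countSub-∷ P x (filterᵇ Q xs) ⟩
      countSub (P ∘ (x ∷_)) (filterᵇ Q xs) + countSub P (filterᵇ Q xs)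
        ≡⟨ cong₂ _+_ (countSub-filter (P ∘ (x ∷_)) Q xs) (countSub-filter P Q xs) ⟩
      countSub (λ H → all Q H ∧ P (x ∷ H)) xs + countSub (λ H → all Q H ∧ P H) xs
        ≡⟨ cong (_+ _) (countSub-cong xs λ H → cong (λ b → (b ∧ all Q H) ∧ P (x ∷ H)) (sym Qx)) ⟩
      countSub (λ H → all Q (x ∷ H) ∧ P (x ∷ H)) xs + countSub (λ H → all Q H ∧ P H) xs
        ≡⟨ countSub-∷ (λ H → all Q H ∧ P H) x xs ⟨
      countSub (λ H → all Q H ∧ P H) (x ∷ xs) ∎
    ... | false = begin
      countSub P (filterᵇ Q xs)                                                    ≡⟨ countSub-filter P Q xs ⟩
      countSub (λ H → all Q H ∧ P H) xs                                           ≡⟨ cong (_+ _) rejected ⟨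
      countSub (λ H → all Q (x ∷ H) ∧ P (x ∷ H)) xs + countSub (λ H → all Q H ∧ P H) xs
        ≡⟨ countSub-∷ (λ H → all Q H ∧ P H) x xs ⟨
      countSub (λ H → all Q H ∧ P H) (x ∷ xs) ∎
      where
      rejected : countSub (λ H → all Q (x ∷ H) ∧ P (x ∷ H)) xs ≡ 0
      rejected = countSub-none xs λ H t → subst T Qx (proj₁ (to T-∧ (proj₁ (to T-∧ t))))

    countSub-empty : ∀ (xs : List A) → countSub (λ H → length H ≡ᵇ 0) xs ≡ 1
    countSub-empty []       = refl
    countSub-empty (x ∷ xs) = trans (countSub-∷ (λ H → length H ≡ᵇ 0) x xs)
                                    (cong₂ _+_ (countSub-none xs λ H ()) (countSub-empty xs))

    countSub-singletons : ∀ (xs : List A) → countSub (λ H → length H ≡ᵇ 1) xs ≡ length xs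
    countSub-singletons []       = refl
    countSub-singletons (x ∷ xs) = trans (countSub-∷ (λ H → length H ≡ᵇ 1) x xs)
                                         (cong₂ _+_ (countSub-empty xs) (countSub-singletons xs))

  subgraphs-map : ∀ {A B : Set} (g : A → B) xs → subgraphs (map g xs) ≡ map (map g) (subgraphs xs)
  subgraphs-map g []       = refl
  subgraphs-map g (x ∷ xs) = begin
    map (g x ∷_) (subgraphs (map g xs)) ++ subgraphs (map g xs)
      ≡⟨ cong (λ S → map (g x ∷_) S ++ S) (subgraphs-map g xs) ⟩
    map (g x ∷_) (map (map g) S) ++ map (map g) S
      ≡⟨ cong (_++ _) (trans (sym (map-∘ S)) (map-∘ S)) ⟩
    map (map g) (map (x ∷_) S) ++ map (map g) S
      ≡⟨ map-++ (map g) (map (x ∷_) S) S ⟨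
    map (map g) (map (x ∷_) S ++ S) ∎
    where
    S : List (List _)
    S = subgraphs xs

  countSub-map : ∀ {A B : Set} (P : List B → Bool) (g : A → B) xs → countSub P (map g xs) ≡ countSub (P ∘ map g) xs
  countSub-map P g xs = trans (cong (length ∘ filterᵇ P) (subgraphs-map g xs)) (length-filterᵇ-map P (map g) (subgraphs xs))

  countSub-++ : ∀ {A : Set} (P : List A → Bool) xs ys →
                countSub P (xs ++ ys) ≡ sum (map (λ S → countSub (P ∘ (S ++_)) ys) (subgraphs xs))
  countSub-++ P []       ys = sym (+-identityʳ _)
  countSub-++ P (x ∷ xs) ys = begin
    countSub P (x ∷ xs ++ ys)
      ≡⟨ countSub-∷ P x (xs ++ ys) ⟩
    countSub (P ∘ (x ∷_)) (xs ++ ys) + countSub P (xs ++ ys)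
      ≡⟨ cong₂ _+_ (countSub-++ (P ∘ (x ∷_)) xs ys) (countSub-++ P xs ys) ⟩
    sum (map (F ∘ (x ∷_)) S) + sum (map F S)
      ≡⟨ cong (_+ sum (map F S)) (cong sum (map-∘ S)) ⟩
    sum (map F (map (x ∷_) S)) + sum (map F S)
      ≡⟨ sum-++ (map F (map (x ∷_) S)) (map F S) ⟨
    sum (map F (map (x ∷_) S) ++ map F S)
      ≡⟨ cong sum (map-++ F (map (x ∷_) S) S) ⟨
    sum (map F (subgraphs (x ∷ xs))) ∎
    where
    S : List (List _)
    S = subgraphs xs
    F : List _ → ℕ
    F H = countSub (P ∘ (H ++_)) ys

  countSub-∧ˡ : ∀ {A : Set} b (Q : List A → Bool) xs → countSub (λ H → b ∧ Q H) xs ≡ b2n b * countSub Q xs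
  countSub-∧ˡ true  Q xs = sym (+-identityʳ _)
  countSub-∧ˡ false Q xs = countSub-none xs λ H ()

  isHam-↭ : ∀ {n} k → Respects-↭ (isHam {n} k)
  isHam-↭ {n} k H↭H′ = cong₂ _∧_
    (cong and (map-cong (λ v → cong (_≡ᵇ 2) (deg-↭ H↭H′ v)) (allFin n)))
    (cong (_≡ᵇ k) (components-↭ H↭H′))

  -- Deletion and contraction

  -- du, dv are the degrees of the endpoints u, v of e in a subgraph H of G − e, off says that all other
  -- vertices have degree 2, and c, c′ say that the contractions merging v into u, resp. u into v, have k
  -- components.  The four terms are the indicators of H + e, H in G − u, H in G − v and H in G / e.
  indicator-identity : ∀ du dv off c c′ → (du ≡ 0 → c′ ≡ c) →
    b2n (((du ≡ᵇ 1) ∧ (dv ≡ᵇ 1) ∧ off) ∧ c) + b2n ((du ≡ᵇ 0) ∧ ((du + dv ≡ᵇ 2) ∧ off) ∧ c′)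
      + b2n ((dv ≡ᵇ 0) ∧ ((du + dv ≡ᵇ 2) ∧ off) ∧ c)
    ≡ b2n (((du + dv ≡ᵇ 2) ∧ off) ∧ c)
  indicator-identity 0                   0             off c c′ c′≡c = refl
  indicator-identity 0                   1             off c c′ c′≡c = refl
  indicator-identity 0                   2             off c c′ c′≡c rewrite c′≡c refl = +-identityʳ _
  indicator-identity 0                   (suc (suc (suc _))) off c c′ c′≡c = refl
  indicator-identity 1                   0             off c c′ c′≡c = refl
  indicator-identity 1                   1             off c c′ c′≡c = trans (+-identityʳ _) (+-identityʳ _)
  indicator-identity 1                   (suc (suc _)) off c c′ c′≡c = refl
  indicator-identity 2                   0             off c c′ c′≡c = refl
  indicator-identity 2                   (suc _)       off c c′ c′≡c = refl
  indicator-identity (suc (suc (suc _))) 0             off c c′ c′≡c = refl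
  indicator-identity (suc (suc (suc _))) (suc _)       off c c′ c′≡c = refl

  module DeletionContraction {n} (G : Graph (suc n)) (e : Fin (length G)) (u≢v : src G e ≢ tgt G e) (k : ℕ) where

    u v : Fin (suc n)
    u = src G e
    v = tgt G e

    G−e : Graph (suc n)
    G−e = removeAt G e

    -- mergeU glues u to v and renumbers by punchOut u, the vertex numbering of G − u.
    mergeV mergeU : Fin (suc n) → Fin n
    mergeV = merge u≢v
    mergeU = merge (u≢v ∘ sym)

    isMergeV : IsMerge mergeV u v
    isMergeV = merge-isMerge u≢v

    isMergeU : IsMerge mergeU u v
    isMergeU = IsMerge-sym (merge-isMerge (u≢v ∘ sym))

    withEdge avoidingU avoidingV contracted : Graph (suc n) → Bool
    withEdge   H = isHam k ((u , v) ∷ H)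
    avoidingU  H = all (avoids u) H ∧ isHam k (relabel mergeU H)
    avoidingV  H = all (avoids v) H ∧ isHam k (relabel mergeV H)
    contracted H = isHam k (relabel mergeV H)

    indicators : ∀ H → b2n (withEdge H) + b2n (avoidingU H) + b2n (avoidingV H) ≡ b2n (contracted H)
    indicators H
      rewrite twoRegular-∷ H u≢v | Merge.components-merge isMergeV H | all-avoids≡deg0 H u | all-avoids≡deg0 H v
            | Merge.twoRegular-relabel isMergeU H | Merge.twoRegular-relabel isMergeV H =
      indicator-identity (deg H u) (deg H v) (twoRegularOff H u v)
        (components (relabel mergeV H) ≡ᵇ k) (components (relabel mergeU H) ≡ᵇ k)
        λ du≡0 → let isolated = avoids⇒isolated H u (subst T (sym (all-avoids≡deg0 H u)) (≡⇒≡ᵇ _ 0 du≡0)) in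
          cong (_≡ᵇ k) (suc-injective (trans (sym (Merge.components-merge-isolated isMergeU H isolated))
                                             (Merge.components-merge-isolated isMergeV H isolated)))

    h-G : h k G ≡ countSub withEdge G−e + h k G−e
    h-G = trans (countSub-↭ (isHam k) (isHam-↭ k) (removeAt-↭ G e)) (countSub-∷ (isHam k) (lookup G e) G−e)

    h-contract : h k (contract G e u≢v) ≡ countSub contracted G−e
    h-contract = countSub-map (isHam k) _ G−e

    h-deleteVertex : ∀ w (mergeW : Fin (suc n) → Fin n) → (∀ x (w≢x : w ≢ x) → mergeW x ≡ punchOut w≢x) →
                     ¬ T (avoids w (u , v)) →
                     h k (deleteVertex G w) ≡ countSub (λ H → all (avoids w) H ∧ isHam k (relabel mergeW H)) G−e
    h-deleteVertex w mergeW mergeW≡punchOut e-hits-w = begin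
      h k (deleteVertex G w)
        ≡⟨ cong (h k) (deleteVertex≡relabel-filter G w mergeW mergeW≡punchOut) ⟩
      countSub (isHam k) (relabel mergeW (filterᵇ (avoids w) G))
        ≡⟨ countSub-map (isHam k) _ (filterᵇ (avoids w) G) ⟩
      countSub (isHam k ∘ relabel mergeW) (filterᵇ (avoids w) G)
        ≡⟨ countSub-filter (isHam k ∘ relabel mergeW) (avoids w) G ⟩
      countSub P G
        ≡⟨ countSub-↭ P P-↭ (removeAt-↭ G e) ⟩
      countSub P (lookup G e ∷ G−e)
        ≡⟨ countSub-∷ P (lookup G e) G−e ⟩
      countSub (P ∘ ((u , v) ∷_)) G−e + countSub P G−e
        ≡⟨ cong (_+ countSub P G−e) (countSub-none G−e λ H t → e-hits-w (proj₁ (to T-∧ (proj₁ (to T-∧ t))))) ⟩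
      countSub P G−e ∎
      where
      P : Graph (suc n) → Bool
      P H = all (avoids w) H ∧ isHam k (relabel mergeW H)
      P-↭ : Respects-↭ P
      P-↭ H↭H′ = cong₂ _∧_ (all-↭ (avoids w) H↭H′) (isHam-↭ k (relabel-↭ mergeW H↭H′))

    h-deleteU : h k (deleteVertex G u) ≡ countSub avoidingU G−e
    h-deleteU = h-deleteVertex u mergeU (merge-≢ (u≢v ∘ sym))
      (λ t → subst (T ∘ not) (==-refl u) (proj₁ (to T-∧ t)))

    h-deleteV : h k (deleteVertex G v) ≡ countSub avoidingV G−e
    h-deleteV = h-deleteVertex v mergeV (merge-≢ u≢v)
      (λ t → subst (T ∘ not) (==-refl v) (proj₂ (to (T-∧ {not (v == u)}) t)))

    deletion-contraction : h k G + h k (deleteVertex G u) + h k (deleteVertex G v)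
                         ≡ h k (deleteEdge G e) + h k (contract G e u≢v)
    deletion-contraction = begin
      h k G + h k (deleteVertex G u) + h k (deleteVertex G v)
        ≡⟨ cong₂ _+_ (cong₂ _+_ h-G h-deleteU) h-deleteV ⟩
      a + h k G−e + b + c
        ≡⟨ ℕ-Solver.solve 4 (λ a b c r → a :+ r :+ b :+ c := r :+ (a :+ b :+ c)) refl a b c (h k G−e) ⟩
      h k G−e + (a + b + c)
        ≡⟨ cong (h k G−e +_) (countSub-+₃ withEdge avoidingU avoidingV contracted G−e indicators) ⟩
      h k G−e + countSub contracted G−e
        ≡⟨ cong (h k G−e +_) h-contract ⟨
      h k G−e + h k (contract G e u≢v) ∎
      where
      open ℕ-Solver using (_:+_; _:=_)
      a b c : ℕ
      a = countSub withEdge G−e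
      b = countSub avoidingU G−e
      c = countSub avoidingV G−e

  -- Disjoint unions

  module Embedding {n m} (g : Fin n → Fin m) (g-injective : ∀ {a b} → g a ≡ g b → a ≡ b) where

    ==-embed : ∀ p c → (g p == g c) ≡ (p == c)
    ==-embed p c = T-≡ext (≡⇒== ∘ g-injective ∘ ==⇒≡) (≡⇒== ∘ cong g ∘ ==⇒≡)

    deg-embed : ∀ H c → deg (relabel g H) (g c) ≡ deg H c
    deg-embed []            c = refl
    deg-embed ((s , t) ∷ H) c rewrite ==-embed s c | ==-embed t c | deg-embed H c = refl

    deg-outside : ∀ H w → (∀ c → g c ≢ w) → deg (relabel g H) w ≡ 0
    deg-outside []            w outside = refl
    deg-outside ((s , t) ∷ H) w outside rewrite ==-≢ (outside s) | ==-≢ (outside t) = deg-outside H w outside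

    Avoids : Fin m × Fin m → Set
    Avoids (x , y) = (∀ c → g c ≢ x) × (∀ c → g c ≢ y)

    record Embeds (H : Graph n) (K : Graph m) : Set where
      field
        image⊆  : ∀ {e} → e ∈ relabel g H → e ∈ K
        outside : ∀ {e} → e ∈ K → e ∈ relabel g H ⊎ Avoids e

    module _ {H K} (H↪K : Embeds H K) where
      open Embeds H↪K

      walk-embed : ∀ {p q} → Walk H p q → Walk K (g p) (g q)
      walk-embed = Star.gmap g λ where
        (inj₁ e) → inj₁ (image⊆ (∈-map⁺ _ e))
        (inj₂ e) → inj₂ (image⊆ (∈-map⁺ _ e))

      walk-from-image : ∀ {x w} → Walk K x w → ∀ {p} → g p ≡ x → ∃[ q ] g q ≡ w × Walk H p q
      walk-from-image ε            gp≡x = _ , gp≡x , ε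
      walk-from-image (inj₁ e ◅ w) {p} gp≡x with outside e
      ... | inj₂ (avoids-x , _) = ⊥-elim (avoids-x p gp≡x)
      ... | inj₁ e′ with ∈-map⁻ _ e′
      ...   | (s , t) , st∈H , refl = let q , gq≡w , w′ = walk-from-image w refl in
        q , gq≡w , inj₁ (subst (λ r → (r , t) ∈ H) (sym (g-injective gp≡x)) st∈H) ◅ w′
      walk-from-image (inj₂ e ◅ w) {p} gp≡x with outside e
      ... | inj₂ (_ , avoids-y) = ⊥-elim (avoids-y p gp≡x)
      ... | inj₁ e′ with ∈-map⁻ _ e′
      ...   | (s , t) , st∈H , refl = let q , gq≡w , w′ = walk-from-image w refl in
        q , gq≡w , inj₂ (subst (λ r → (s , r) ∈ H) (sym (g-injective gp≡x)) st∈H) ◅ w′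

      walk-unembed : ∀ {p q} → Walk K (g p) (g q) → Walk H p q
      walk-unembed w with walk-from-image w refl
      ... | q , gq≡gq′ , w′ = subst (Walk H _) (g-injective gq≡gq′) w′

      -- Stated additively: the new edge joins two components of H exactly when its image joins two of K.
      components-embed-∷ : ∀ p q → components ((g p , g q) ∷ K) + components H ≡ components K + components ((p , q) ∷ H)
      components-embed-∷ p q with walk? H p q
      ... | yes w = cong₂ _+_ (components-∷-walk K (walk-embed w)) (sym (components-∷-walk H w))
      ... | no ¬w = suc-injective (begin
        suc (components ((g p , g q) ∷ K)) + components H      ≡⟨ cong (_+ _) (components-∷-¬walk K (¬w ∘ walk-unembed)) ⟩
        components K + components H                            ≡⟨ cong (components K +_) (components-∷-¬walk H ¬w) ⟨
        components K + suc (components ((p , q) ∷ H))          ≡⟨ +-suc _ _ ⟩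
        suc (components K + components ((p , q) ∷ H))          ∎)

  module DisjointUnion (n₁ n₂ : ℕ) where

    ι₁ : Fin n₁ → Fin (n₁ + n₂)
    ι₁ a = a ↑ˡ n₂

    ι₂ : Fin n₂ → Fin (n₁ + n₂)
    ι₂ b = n₁ ↑ʳ b

    ι₁≢ι₂ : ∀ a b → ι₁ a ≢ ι₂ b
    ι₁≢ι₂ a b eq with trans (sym (splitAt-↑ˡ n₁ a n₂)) (trans (cong (splitAt n₁) eq) (splitAt-↑ʳ n₁ n₂ b))
    ... | ()

    ι₁-or-ι₂ : ∀ w → (∃[ a ] ι₁ a ≡ w) ⊎ (∃[ b ] ι₂ b ≡ w)
    ι₁-or-ι₂ w with splitAt n₁ w in eq
    ... | inj₁ a = inj₁ (a , splitAt⁻¹-↑ˡ eq)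
    ... | inj₂ b = inj₂ (b , splitAt⁻¹-↑ʳ eq)

    module E₁ = Embedding ι₁ (↑ˡ-injective n₂ _ _)
    module E₂ = Embedding ι₂ (↑ʳ-injective n₁ _ _)

    private
      offset-preserved : ∀ {k k′ c c′} d → k′ + c ≡ k + c′ → k ≡ c + d → k′ ≡ c′ + d
      offset-preserved {k} {k′} {c} {c′} d step k≡c+d = +-cancelʳ-≡ c k′ (c′ + d)
        (trans step (trans (cong (_+ c′) k≡c+d) (xy∙z≈zy∙x c d c′)))

    components-right : ∀ T → components (relabel ι₂ T) ≡ components T + n₁
    components-right [] = trans components-[] (trans (+-comm n₁ n₂) (cong (_+ n₁) (sym components-[])))
    components-right ((p , q) ∷ T) =
      offset-preserved n₁ (E₂.components-embed-∷ T↪ p q) (components-right T)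
      where
      T↪ : E₂.Embeds T (relabel ι₂ T)
      T↪ = record { image⊆ = λ e → e ; outside = inj₁ }

    components-⊕ : ∀ S T → components (relabel ι₁ S ++ relabel ι₂ T) ≡ components S + components T
    components-⊕ [] T = trans (components-right T) (trans (+-comm _ n₁) (cong (_+ components T) (sym components-[])))
    components-⊕ ((p , q) ∷ S) T =
      offset-preserved (components T) (E₁.components-embed-∷ S↪ p q) (components-⊕ S T)
      where
      S↪ : E₁.Embeds S (relabel ι₁ S ++ relabel ι₂ T)
      S↪ = record { image⊆ = ∈-++⁺ˡ ; outside = outside }
        where
        outside : ∀ {e} → e ∈ relabel ι₁ S ++ relabel ι₂ T → e ∈ relabel ι₁ S ⊎ E₁.Avoids e
        outside e∈ with ∈-++⁻ (relabel ι₁ S) e∈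
        ... | inj₁ e∈S = inj₁ e∈S
        ... | inj₂ e∈T with ∈-map⁻ _ e∈T
        ...   | (x , y) , _ , refl = inj₂ ((λ a → ι₁≢ι₂ a x) , (λ a → ι₁≢ι₂ a y))

    deg-⊕ˡ : ∀ S T a → deg (relabel ι₁ S ++ relabel ι₂ T) (ι₁ a) ≡ deg S a
    deg-⊕ˡ S T a = trans (deg-++ (relabel ι₁ S) (relabel ι₂ T) (ι₁ a))
      (trans (cong₂ _+_ (E₁.deg-embed S a) (E₂.deg-outside T (ι₁ a) (λ b → ι₁≢ι₂ a b ∘ sym))) (+-identityʳ _))

    deg-⊕ʳ : ∀ S T b → deg (relabel ι₁ S ++ relabel ι₂ T) (ι₂ b) ≡ deg T b
    deg-⊕ʳ S T b = trans (deg-++ (relabel ι₁ S) (relabel ι₂ T) (ι₂ b))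
      (cong₂ _+_ (E₁.deg-outside S (ι₂ b) (λ a → ι₁≢ι₂ a b)) (E₂.deg-embed T b))

    twoRegular-⊕ : ∀ S T → twoRegular (relabel ι₁ S ++ relabel ι₂ T) ≡ twoRegular S ∧ twoRegular T
    twoRegular-⊕ S T = T-≡ext
      (λ t → let d = to (T-twoRegular (relabel ι₁ S ++ relabel ι₂ T)) t in
        from (T-∧ {twoRegular S})
          ( from (T-twoRegular S) (λ a → trans (sym (deg-⊕ˡ S T a)) (d (ι₁ a)))
          , from (T-twoRegular T) (λ b → trans (sym (deg-⊕ʳ S T b)) (d (ι₂ b)))))
      (λ t → let tS , tT = to (T-∧ {twoRegular S}) t in
        from (T-twoRegular (relabel ι₁ S ++ relabel ι₂ T)) λ w → deg2 w (to (T-twoRegular S) tS) (to (T-twoRegular T) tT))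
      where
      deg2 : ∀ w → (∀ a → deg S a ≡ 2) → (∀ b → deg T b ≡ 2) → deg (relabel ι₁ S ++ relabel ι₂ T) w ≡ 2
      deg2 w dS dT with ι₁-or-ι₂ w
      ... | inj₁ (a , refl) = trans (deg-⊕ˡ S T a) (dS a)
      ... | inj₂ (b , refl) = trans (deg-⊕ʳ S T b) (dT b)

    isHam-⊕ : ∀ k S T → isHam k (relabel ι₁ S ++ relabel ι₂ T)
                        ≡ (twoRegular S ∧ twoRegular T) ∧ (components S + components T ≡ᵇ k)
    isHam-⊕ k S T = cong₂ _∧_ (twoRegular-⊕ S T) (cong (_≡ᵇ k) (components-⊕ S T))

  h-⊕ : ∀ {n₁ n₂} (G₁ : Graph n₁) (G₂ : Graph n₂) k → h k (G₁ ⊕ G₂) ≡ convolution k G₁ G₂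
  h-⊕ {n₁} {n₂} G₁ G₂ k = begin
    h k (G₁ ⊕ G₂)
      ≡⟨ countSub-++ (isHam k) (relabel ι₁ G₁) (relabel ι₂ G₂) ⟩
    sum (map F (subgraphs (relabel ι₁ G₁)))
      ≡⟨ cong (sum ∘ map F) (subgraphs-map _ G₁) ⟩
    sum (map F (map (relabel ι₁) (subgraphs G₁)))
      ≡⟨ cong sum (map-∘ (subgraphs G₁)) ⟨
    sum (map (F ∘ relabel ι₁) (subgraphs G₁))
      ≡⟨ cong sum (map-cong by-components (subgraphs G₁)) ⟩
    sum (map (λ S → sum (map (λ i → b2n (isHam i S) * h (k ∸ i) G₂) (upTo (suc k)))) (subgraphs G₁))
      ≡⟨ sum-map-swap (λ S i → b2n (isHam i S) * h (k ∸ i) G₂) (subgraphs G₁) (upTo (suc k)) ⟩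
    sum (map (λ i → sum (map (λ S → b2n (isHam i S) * h (k ∸ i) G₂) (subgraphs G₁))) (upTo (suc k)))
      ≡⟨ cong sum (map-cong (λ i → trans (sum-map-*ʳ (b2n ∘ isHam i) (h (k ∸ i) G₂) (subgraphs G₁))
                                         (cong (_* h (k ∸ i) G₂) (sym (countSub≡sum (isHam i) G₁))))
                            (upTo (suc k))) ⟩
    convolution k G₁ G₂ ∎
    where
    open DisjointUnion n₁ n₂
    F : Graph (n₁ + n₂) → ℕ
    F S = countSub (isHam k ∘ (S ++_)) (relabel ι₂ G₂)
    by-components : ∀ S → F (relabel ι₁ S) ≡ sum (map (λ i → b2n (isHam i S) * h (k ∸ i) G₂) (upTo (suc k)))
    by-components S = begin
      countSub (λ T → isHam k (relabel ι₁ S ++ T)) (relabel ι₂ G₂)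
        ≡⟨ countSub-map (λ T → isHam k (relabel ι₁ S ++ T)) _ G₂ ⟩
      countSub (λ T → isHam k (relabel ι₁ S ++ relabel ι₂ T)) G₂
        ≡⟨ countSub-cong G₂ (λ T → trans (isHam-⊕ k S T) (regroup T)) ⟩
      countSub (λ T → (twoRegular S ∧ (cS ≤ᵇ k)) ∧ isHam (k ∸ cS) T) G₂
        ≡⟨ countSub-∧ˡ (twoRegular S ∧ (cS ≤ᵇ k)) (isHam (k ∸ cS)) G₂ ⟩
      b2n (twoRegular S ∧ (cS ≤ᵇ k)) * h (k ∸ cS) G₂
        ≡⟨ sum-upTo-indicator (twoRegular S) cS k (λ i → h (k ∸ i) G₂) ⟨
      sum (map (λ i → b2n (isHam i S) * h (k ∸ i) G₂) (upTo (suc k))) ∎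
      where
      cS : ℕ
      cS = components S
      regroup : ∀ T → (twoRegular S ∧ twoRegular T) ∧ (cS + components T ≡ᵇ k)
                      ≡ (twoRegular S ∧ (cS ≤ᵇ k)) ∧ isHam (k ∸ cS) T
      regroup T rewrite ≡ᵇ-+ cS (components T) k with twoRegular S | cS ≤ᵇ k
      ... | true  | true  = refl
      ... | true  | false = ∧-zeroʳ (twoRegular T)
      ... | false | _     = refl

  -- One vertex with loops

  deg-one-vertex : ∀ (H : Graph 1) → deg H fzero ≡ length H + length H
  deg-one-vertex []                    = refl
  deg-one-vertex ((fzero , fzero) ∷ H) =
    cong suc (trans (cong suc (deg-one-vertex H)) (sym (+-suc (length H) (length H))))

  isHam-one-vertex : ∀ k (H : Graph 1) → isHam k H ≡ (length H ≡ᵇ 1) ∧ (1 ≡ᵇ k)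
  isHam-one-vertex k H rewrite deg-one-vertex H = cong (_∧ (1 ≡ᵇ k)) (double≡ᵇ2 (length H))
    where
    double≡ᵇ2 : ∀ m → (m + m ≡ᵇ 2) ∧ true ≡ (m ≡ᵇ 1)
    double≡ᵇ2 0             = refl
    double≡ᵇ2 1             = refl
    double≡ᵇ2 (suc (suc m)) rewrite +-suc m (suc m) = refl

  h-K1-1 : ∀ n → h 1 (K1 n) ≡ n
  h-K1-1 n = begin
    h 1 (K1 n)                                  ≡⟨ countSub-cong (K1 n) (λ H → trans (isHam-one-vertex 1 H) (∧-identityʳ _)) ⟩
    countSub (λ H → length H ≡ᵇ 1) (K1 n)       ≡⟨ countSub-singletons (K1 n) ⟩
    length (K1 n)                               ≡⟨ length-replicate n ⟩
    n                                           ∎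

  h-K1-≢1 : ∀ n k → k ≢ 1 → h k (K1 n) ≡ 0
  h-K1-≢1 n k k≢1 = countSub-none (K1 n) λ H t →
    k≢1 (sym (≡ᵇ⇒≡ 1 k (proj₂ (to T-∧ (subst T (isHam-one-vertex k H) t)))))

open HamiltonianCycleCounts using (module DeletionContraction; h-⊕; h-K1-1; h-K1-≢1)

open import Defs
open import Data.Nat using (ℕ; suc)
import Data.Nat as ℕ
open import Data.Integer using (+_; _+_; _-_)
open import Data.Integer.Properties using (pos-+)
import Data.Integer.Solver
open import Data.Fin using (Fin)
open import Data.List using (length)
open import Data.Product using (_×_; _,_)
open import Relation.Binary.PropositionalEquality using (_≡_; _≢_; refl; sym; trans; cong; module ≡-Reasoning)

a+b+c≡d+e⇒a≡d+e-b-c : ∀ {a b c d e} → a ℕ.+ b ℕ.+ c ≡ d ℕ.+ e → + a ≡ (+ d + + e) - + b - + c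
a+b+c≡d+e⇒a≡d+e-b-c {a} {b} {c} {d} {e} eq = begin
  + a                            ≡⟨ solve 3 (λ a b c → a := a :+ b :+ c :- b :- c) refl (+ a) (+ b) (+ c) ⟩
  (+ a + + b + + c) - + b - + c  ≡⟨ cong (λ z → z - + b - + c) (trans (cong (_+ + c) (pos-+ a b)) (pos-+ (a ℕ.+ b) c)) ⟨
  + (a ℕ.+ b ℕ.+ c) - + b - + c  ≡⟨ cong (λ z → + z - + b - + c) eq ⟩
  + (d ℕ.+ e) - + b - + c        ≡⟨ cong (λ z → z - + b - + c) (pos-+ d e) ⟩
  (+ d + + e) - + b - + c        ∎
  where
  open ≡-Reasoning
  open Data.Integer.Solver.+-*-Solver using (solve; _:+_; _:-_; _:=_)

lemma1 :
    (∀ {n} (G : Graph (suc n)) (e : Fin (length G)) (u≢v : src G e ≢ tgt G e) (k : ℕ) →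
       + h k G ≡ (+ h k (deleteEdge G e) + + h k (contract G e u≢v))
                 - + h k (deleteVertex G (src G e)) - + h k (deleteVertex G (tgt G e)))
    × (∀ {n₁ n₂} (G₁ : Graph (suc n₁)) (G₂ : Graph (suc n₂)) (k : ℕ) →
       h k (G₁ ⊕ G₂) ≡ convolution k G₁ G₂)
    × (∀ (n : ℕ) → h 1 (K1 n) ≡ n)
    × (∀ (n k : ℕ) → k ≢ 1 → h k (K1 n) ≡ 0)
lemma1 = (λ G e u≢v k → a+b+c≡d+e⇒a≡d+e-b-c {d = h k (deleteEdge G e)} {e = h k (contract G e u≢v)}
                             (DeletionContraction.deletion-contraction G e u≢v k))
       , h-⊕
       , h-K1-1
       , h-K1-≢1
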